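{- Let $G$ be a graph and let $U$ and $V$ be disjoint sets of vertices of $G$ such that each $u\in U$ is adjacent in $G$ to at most two vertices of $V$. If $|U|\geq 4$ and $|V|\geq 6$, then $\overline{G}[U\cup V]$ contains a cycle $C_8$.
   Context: Graphs are finite and simple; $\overline{G}$ is the complement of $G$ and $\overline{G}[X]$ is the subgraph of $\overline{G}$ induced by $X$. -}

module Defs where

open import Data.Nat using (ℕ; _≤_)
open import Data.Bool using (Bool; true; false; _∧_)
open import Data.Fin using (Fin; zero; suc; inject₁; fromℕ)
open import Data.Fin.Subset using (Subset; _∈_; _∪_; ∣_∣; Empty; _∩_)
open import Data.Vec using (lookup; tabulate)
open import Data.Product using (Σ; _×_)
open import Function.Definitions using (Injective)
open import Relation.Binary.PropositionalEquality using (_≡_)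

record Graph (n : ℕ) : Set where
  field
    adj   : Fin n → Fin n → Bool
    sym   : ∀ u v → adj u v ≡ adj v u
    irrefl : ∀ v → adj v v ≡ false

open Graph public

neighboursIn : ∀ {n} → Graph n → Fin n → Subset n → Subset n
neighboursIn G u V = tabulate (λ v → lookup V v ∧ adj G u v)

Disjoint : ∀ {n} → Subset n → Subset n → Set
Disjoint U V = Empty (U ∩ V)

ComplEdge : ∀ {n} → Graph n → Fin n → Fin n → Set
ComplEdge G u v = adj G u v ≡ false

HasComplC8 : ∀ {n} → Graph n → Subset n → Set
HasComplC8 {n} G X =
  Σ (Fin 8 → Fin n) λ f →
    Injective _≡_ _≡_ f ×
    (∀ i → f i ∈ X) ×
    (∀ (i : Fin 7) → ComplEdge G (f (inject₁ i)) (f (suc i))) ×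
    ComplEdge G (f (fromℕ 7)) (f zero)

-- Fix four vertices u₀,…,u₃ of U and six vertices v₀,…,v₅ of V, and let Bᵢ ⊆ {0,…,5} index the
-- G-neighbours of uᵢ among the vⱼ, so |Bᵢ| ≤ 2. For a Hamiltonian cycle s of K₄, an 8-cycle
-- u_{s₀} a₀ u_{s₁} a₁ u_{s₂} a₂ u_{s₃} a₃ of the complement is a system of distinct representatives
-- aₖ of the complements of B_{sₖ} ∪ B_{sₖ₊₁}. Enlarging the Bᵢ only makes this harder, so we may
-- assume |Bᵢ| = 2; each of the resulting 15⁴ configurations is then settled by a backtracking
-- search, run by the type checker, whose answer carries its own correctness proof.
module Submission where

open import Defs hiding (sym)
open import Data.Nat using (ℕ; zero; suc; pred; _≤_; _+⋎_; z≤n; s≤s)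
open import Data.Nat.Properties using (≤-refl; ≤-trans; ≤-antisym; _≤?_; ≰⇒>)
open import Data.Bool using (Bool; true; false; T; _∧_)
open import Data.Bool.Properties using (¬-not; T-∧)
open import Data.Unit using (tt)
open import Data.Fin using (Fin; zero; suc; inject₁; inject≤; fromℕ; _≟_; #_)
open import Data.Fin.Properties using (injective⇒≤; suc-injective; inject≤-injective)
open import Data.Fin.Subset using (Subset; _∈_; _∉_; _⊆_; _∪_; _∩_; ∁; ∣_∣)
open import Data.Fin.Subset.Properties
  using (∣p∣≤n; in⊆in; out⊆; x∈p∪q⁺; x∈p∩q⁺; x∈p∩q⁻; x∈∁p⇒x∉p)
open import Data.Vec using (Vec; []; _∷_; lookup; tabulate; here; there)
import Data.Vec as Vec
open import Data.Vec.Properties using ([]=⇒lookup; lookup⇒[]=; lookup∘tabulate)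
open import Data.Vec.Relation.Unary.All using (All; []; _∷_)
import Data.Vec.Relation.Unary.All as All
open import Data.Vec.Relation.Unary.All.Properties using (tabulate⁺)
open import Data.Vec.Relation.Unary.AllPairs using ([]; _∷_; allPairs?)
open import Data.Vec.Relation.Unary.Linked using (Linked; [-]; _∷_) renaming (map to Linked-map)
open import Data.Vec.Relation.Unary.Unique.Propositional using (Unique)
open import Data.Vec.Relation.Unary.Unique.Propositional.Properties using (lookup-injective)
open import Data.Vec.Relation.Binary.Pointwise.Inductive using (Pointwise; []; _∷_)
open import Data.List using (List; []; _∷_; foldr)
open import Data.Maybe using (Maybe; just; nothing; _<∣>_; is-just; to-witness-T)
import Data.Maybe as Maybe
open import Data.Sum using (_⊎_; inj₁; inj₂; [_,_])
open import Data.Sum.Properties using (inj₁-injective; inj₂-injective)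
open import Data.Product using (Σ; ∃; _×_; _,_; proj₁; proj₂; uncurry)
open import Data.Empty using (⊥; ⊥-elim)
open import Function using (_∘_; id)
open import Function.Bundles using (module Equivalence)
open import Function.Definitions using (Injective)
open import Relation.Nullary using (¬?; yes; no)
open import Relation.Nullary.Decidable using (True; toWitness)
open import Relation.Binary.PropositionalEquality
  using (_≡_; _≢_; refl; sym; trans; cong; cong₂; subst)

private
  variable
    n m k : ℕ
    A B C : Set

embed : (p : Subset n) → Fin ∣ p ∣ → Fin n
embed (true ∷ p) zero = zero
embed (true ∷ p) (suc i) = suc (embed p i)
embed (false ∷ p) i = suc (embed p i)

embed-injective : (p : Subset n) → Injective _≡_ _≡_ (embed p)
embed-injective (true ∷ p) {zero} {zero} _ = refl
embed-injective (true ∷ p) {suc i} {suc j} eq = cong suc (embed-injective p (suc-injective eq))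
embed-injective (false ∷ p) eq = embed-injective p (suc-injective eq)

embed-∈ : (p : Subset n) (i : Fin ∣ p ∣) → embed p i ∈ p
embed-∈ (true ∷ p) zero = here
embed-∈ (true ∷ p) (suc i) = there (embed-∈ p i)
embed-∈ (false ∷ p) i = there (embed-∈ p i)

position : {p : Subset n} {x : Fin n} → x ∈ p → Fin ∣ p ∣
position {p = true ∷ p} here = zero
position {p = true ∷ p} (there x∈p) = suc (position x∈p)
position {p = false ∷ p} (there x∈p) = position x∈p

embed-position : {p : Subset n} {x : Fin n} (x∈p : x ∈ p) → embed p (position x∈p) ≡ x
embed-position {p = true ∷ p} here = refl
embed-position {p = true ∷ p} (there x∈p) = cong suc (embed-position x∈p)
embed-position {p = false ∷ p} (there x∈p) = cong suc (embed-position x∈p)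

injective⇒∣p∣≤∣q∣ : {p : Subset k} {q : Subset n} (f : Fin k → Fin n) → Injective _≡_ _≡_ f →
                    (∀ {x} → x ∈ p → f x ∈ q) → ∣ p ∣ ≤ ∣ q ∣
injective⇒∣p∣≤∣q∣ {p = p} f f-injective f-maps = injective⇒≤ index-injective
  where
  index : Fin ∣ p ∣ → Fin _
  index i = position (f-maps (embed-∈ p i))

  embed-index : ∀ i → embed _ (index i) ≡ f (embed p i)
  embed-index i = embed-position (f-maps (embed-∈ p i))

  index-injective : Injective _≡_ _≡_ index
  index-injective {i} {j} eq = embed-injective p (f-injective
    (trans (sym (embed-index i)) (trans (cong (embed _) eq) (embed-index j))))

≤∣p∣⇒injection : (p : Subset n) → m ≤ ∣ p ∣ →
                 Σ (Fin m → Fin n) λ f → Injective _≡_ _≡_ f × (∀ i → f i ∈ p)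
≤∣p∣⇒injection {m = m} p m≤∣p∣ =
  embed p ∘ inject ,
  (λ eq → inject≤-injective m≤∣p∣ m≤∣p∣ _ _ (embed-injective p eq)) ,
  embed-∈ p ∘ inject
  where
  inject : Fin m → Fin ∣ p ∣
  inject i = inject≤ i m≤∣p∣

extendToSize : (p : Subset n) → ∣ p ∣ ≤ k → k ≤ n → Σ (Subset n) λ q → p ⊆ q × ∣ q ∣ ≡ k
extendToSize [] z≤n z≤n = [] , id , refl
extendToSize (true ∷ p) (s≤s ∣p∣≤k) (s≤s k≤n) =
  let q , p⊆q , ∣q∣≡k = extendToSize p ∣p∣≤k k≤n in true ∷ q , in⊆in p⊆q , cong suc ∣q∣≡k
extendToSize {suc n} {k} (false ∷ p) ∣p∣≤k k≤1+n with k ≤? n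
... | yes k≤n = let q , p⊆q , ∣q∣≡k = extendToSize p ∣p∣≤k k≤n in false ∷ q , out⊆ p⊆q , ∣q∣≡k
... | no k≰n = let q , p⊆q , ∣q∣≡n = extendToSize p (∣p∣≤n p) ≤-refl in
  true ∷ q , out⊆ p⊆q , trans (cong suc ∣q∣≡n) (≤-antisym (≰⇒> k≰n) k≤1+n)

∈-tabulate⁺ : (f : Fin n → Bool) {x : Fin n} → f x ≡ true → x ∈ tabulate f
∈-tabulate⁺ f {x} fx = lookup⇒[]= x (tabulate f) (trans (lookup∘tabulate f x) fx)

∈-tabulate⁻ : (f : Fin n → Bool) {x : Fin n} → x ∈ tabulate f → f x ≡ true
∈-tabulate⁻ f {x} x∈ = trans (sym (lookup∘tabulate f x)) ([]=⇒lookup x∈)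

∉-tabulate⁻ : (f : Fin n → Bool) {x : Fin n} → x ∉ tabulate f → f x ≡ false
∉-tabulate⁻ f x∉ = ¬-not (x∉ ∘ ∈-tabulate⁺ f)

-- A hand-written p - ⁅ a ⁆, which evaluates much faster in the search below.
remove : Fin n → Subset n → Subset n
remove zero (_ ∷ p) = false ∷ p
remove (suc a) (s ∷ p) = s ∷ remove a p

∈-remove⁻ : {a x : Fin n} {p : Subset n} → x ∈ remove a p → a ≢ x × x ∈ p
∈-remove⁻ {a = zero} {p = _ ∷ p} (there x∈p) = (λ ()) , there x∈p
∈-remove⁻ {a = suc a} {p = _ ∷ p} here = (λ ()) , here
∈-remove⁻ {a = suc a} {p = _ ∷ p} (there x∈) =
  let a≢x , x∈p = ∈-remove⁻ x∈ in a≢x ∘ suc-injective , there x∈p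

firstIn : (p : Subset n) → ((a : Fin n) → a ∈ p → Maybe C) → Maybe C
firstIn [] f = nothing
firstIn (true ∷ p) f = f zero here <∣> firstIn p (λ a a∈p → f (suc a) (there a∈p))
firstIn (false ∷ p) f = firstIn p (λ a a∈p → f (suc a) (there a∈p))

Representatives : Vec (Subset n) k → Set
Representatives {n} {k} ps = Σ (Vec (Fin n) k) λ as → Unique as × Pointwise _∈_ as ps

∈-remove-pointwise⁻ : {a : Fin n} {as : Vec (Fin n) k} {ps : Vec (Subset n) k} →
                      Pointwise _∈_ as (Vec.map (remove a) ps) → All (a ≢_) as × Pointwise _∈_ as ps
∈-remove-pointwise⁻ {ps = []} [] = [] , []
∈-remove-pointwise⁻ {ps = _ ∷ _} (x∈ ∷ xs∈) =
  let a≢x , x∈p = ∈-remove⁻ x∈ ; a∉xs , xs∈ps = ∈-remove-pointwise⁻ xs∈ in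
  a≢x ∷ a∉xs , x∈p ∷ xs∈ps

distinctRepresentatives : (ps : Vec (Subset n) k) → Maybe (Representatives ps)
distinctRepresentatives [] = just ([] , [] , [])
distinctRepresentatives (p ∷ ps) = firstIn p λ a a∈p →
  Maybe.map (prepend a a∈p) (distinctRepresentatives (Vec.map (remove a) ps))
  where
  prepend : ∀ a → a ∈ p → Representatives (Vec.map (remove a) ps) → Representatives (p ∷ ps)
  prepend a a∈p (as , as-unique , as∈) =
    let a∉as , as∈ps = ∈-remove-pointwise⁻ as∈ in a ∷ as , a∉as ∷ as-unique , a∈p ∷ as∈ps

IsC8 : (A → A → Set) → Vec A 8 → Set
IsC8 R w = Unique w × Linked R w × R (lookup w (fromℕ 7)) (lookup w zero)

Linked⇒consecutive : {R : A → A → Set} {w : Vec A (suc n)} → Linked R w →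
                     ∀ (i : Fin n) → R (lookup w (inject₁ i)) (lookup w (suc i))
Linked⇒consecutive {w = _ ∷ _ ∷ _} (r ∷ _) zero = r
Linked⇒consecutive {w = _ ∷ _ ∷ _} (_ ∷ rs) (suc i) = Linked⇒consecutive rs i

IsC8-mono : {R S : A → A → Set} → (∀ {a b} → R a b → S a b) → {w : Vec A 8} → IsC8 R w → IsC8 S w
IsC8-mono R⇒S (unique , linked , closing) = unique , Linked-map R⇒S linked , R⇒S closing

IsC8⇒HasComplC8 : {R : A → A → Set} (G : Graph n) (X : Subset n) (h : A → Fin n) →
                  Injective _≡_ _≡_ h → (∀ a → h a ∈ X) →
                  (∀ {a b} → R a b → ComplEdge G (h a) (h b)) →
                  {w : Vec A 8} → IsC8 R w → HasComplC8 G X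
IsC8⇒HasComplC8 G X h h-injective h∈X R⇒edge {w} (unique , linked , closing) =
  h ∘ lookup w ,
  (λ eq → lookup-injective unique _ _ (h-injective eq)) ,
  h∈X ∘ lookup w ,
  R⇒edge ∘ Linked⇒consecutive linked ,
  R⇒edge closing

interleave : Vec A k → Vec B k → Vec (A ⊎ B) (k +⋎ k)
interleave [] [] = []
interleave (x ∷ xs) (y ∷ ys) = inj₁ x ∷ inj₂ y ∷ interleave xs ys

All-interleave⁺ : {P : A ⊎ B → Set} {xs : Vec A k} {ys : Vec B k} →
                  All (P ∘ inj₁) xs → All (P ∘ inj₂) ys → All P (interleave xs ys)
All-interleave⁺ [] [] = []
All-interleave⁺ (px ∷ pxs) (py ∷ pys) = px ∷ py ∷ All-interleave⁺ pxs pys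

interleave-unique : {xs : Vec A k} {ys : Vec B k} →
                    Unique xs → Unique ys → Unique (interleave xs ys)
interleave-unique {xs = []} {[]} [] [] = []
interleave-unique {xs = _ ∷ _} {_ ∷ _} (x∉xs ∷ xs-unique) (y∉ys ∷ ys-unique) =
  ((λ ()) ∷ All-interleave⁺ (All.map (_∘ inj₁-injective) x∉xs) (All.universal (λ _ ()) _)) ∷
  All-interleave⁺ (All.universal (λ _ ()) _) (All.map (_∘ inj₂-injective) y∉ys) ∷
  interleave-unique xs-unique ys-unique

Vertex : Set
Vertex = Fin 4 ⊎ Fin 6

Compatible : (Fin 4 → Subset 6) → Vertex → Vertex → Set
Compatible Bad (inj₁ i) (inj₂ j) = j ∉ Bad i
Compatible Bad (inj₂ j) (inj₁ i) = j ∉ Bad i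
Compatible Bad _ _ = ⊥

Compatible-antitone : {Bad Bad′ : Fin 4 → Subset 6} → (∀ i → Bad i ⊆ Bad′ i) →
                      ∀ {x y} → Compatible Bad′ x y → Compatible Bad x y
Compatible-antitone Bad⊆Bad′ {inj₁ i} {inj₂ j} j∉ = j∉ ∘ Bad⊆Bad′ i
Compatible-antitone Bad⊆Bad′ {inj₂ j} {inj₁ i} j∉ = j∉ ∘ Bad⊆Bad′ i

cycleAlong : (Bad : Fin 4 → Subset 6) (s : Vec (Fin 4) 4) → Unique s →
             Maybe (∃ (IsC8 (Compatible Bad)))
cycleAlong Bad s@(s₀ ∷ s₁ ∷ s₂ ∷ s₃ ∷ []) s-unique =
  Maybe.map close (distinctRepresentatives allowed)
  where
  avoiding : Fin 4 → Fin 4 → Subset 6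
  avoiding i j = ∁ (Bad i) ∩ ∁ (Bad j)

  allowed : Vec (Subset 6) 4
  allowed = avoiding s₀ s₁ ∷ avoiding s₁ s₂ ∷ avoiding s₂ s₃ ∷ avoiding s₃ s₀ ∷ []

  left : ∀ {i j a} → a ∈ avoiding i j → a ∉ Bad i
  left a∈ = x∈∁p⇒x∉p (proj₁ (x∈p∩q⁻ _ _ a∈))

  right : ∀ {i j a} → a ∈ avoiding i j → a ∉ Bad j
  right a∈ = x∈∁p⇒x∉p (proj₂ (x∈p∩q⁻ _ _ a∈))

  close : Representatives allowed → ∃ (IsC8 (Compatible Bad))
  close (as@(_ ∷ _ ∷ _ ∷ _ ∷ []) , as-unique , a₀∈ ∷ a₁∈ ∷ a₂∈ ∷ a₃∈ ∷ []) =
    interleave s as ,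
    interleave-unique s-unique as-unique ,
    left a₀∈ ∷ right a₀∈ ∷ left a₁∈ ∷ right a₁∈ ∷ left a₂∈ ∷ right a₂∈ ∷ left a₃∈ ∷ [-] ,
    right a₃∈

withUniqueness : (s : Vec (Fin 4) 4) → {True (allPairs? (λ x y → ¬? (x ≟ y)) s)} → ∃ Unique
withUniqueness s {s-unique} = s , toWitness s-unique

-- Up to rotation and reflection, the three Hamiltonian cycles of K₄.
hamiltonianCycles : List (∃ (Unique {A = Fin 4}))
hamiltonianCycles =
  withUniqueness (# 0 ∷ # 1 ∷ # 2 ∷ # 3 ∷ []) ∷
  withUniqueness (# 0 ∷ # 1 ∷ # 3 ∷ # 2 ∷ []) ∷
  withUniqueness (# 0 ∷ # 2 ∷ # 1 ∷ # 3 ∷ []) ∷ []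

findC8 : (Bad : Fin 4 → Subset 6) → Maybe (∃ (IsC8 (Compatible Bad)))
findC8 Bad = foldr (λ s → uncurry (cycleAlong Bad) s <∣>_) nothing hamiltonianCycles

Enumerates : ((A → Bool) → Bool) → (A → Set) → Set
Enumerates {A} Q P = ∀ (f : A → Bool) → T (Q f) → ∀ a → P a → T (f a)

∧-elimˡ : {x y : Bool} → T (x ∧ y) → T x
∧-elimˡ = proj₁ ∘ Equivalence.to T-∧

∧-elimʳ : {x y : Bool} → T (x ∧ y) → T y
∧-elimʳ = proj₂ ∘ Equivalence.to T-∧

allOfSizeᵇ : ℕ → (Subset n → Bool) → Bool
allOfSizeᵇ {zero} zero f = f []
allOfSizeᵇ {zero} (suc k) f = true
allOfSizeᵇ {suc n} zero f = allOfSizeᵇ zero (f ∘ (false ∷_))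
allOfSizeᵇ {suc n} (suc k) f = allOfSizeᵇ (suc k) (f ∘ (false ∷_)) ∧ allOfSizeᵇ k (f ∘ (true ∷_))

allOfSizeᵇ-enumerates : Enumerates (allOfSizeᵇ {n} k) (λ p → ∣ p ∣ ≡ k)
allOfSizeᵇ-enumerates {zero} {zero} f holds [] refl = holds
allOfSizeᵇ-enumerates {suc n} {zero} f holds (false ∷ p) ∣p∣≡0 =
  allOfSizeᵇ-enumerates (f ∘ (false ∷_)) holds p ∣p∣≡0
allOfSizeᵇ-enumerates {suc n} {suc k} f holds (false ∷ p) ∣p∣≡k =
  allOfSizeᵇ-enumerates (f ∘ (false ∷_)) (∧-elimˡ holds) p ∣p∣≡k
allOfSizeᵇ-enumerates {suc n} {suc k} f holds (true ∷ p) ∣p∣≡k =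
  allOfSizeᵇ-enumerates (f ∘ (true ∷_)) (∧-elimʳ {allOfSizeᵇ (suc k) (f ∘ (false ∷_))} holds) p
    (cong pred ∣p∣≡k)

allVecᵇ : ((A → Bool) → Bool) → (Vec A k → Bool) → Bool
allVecᵇ {k = zero} Q f = f []
allVecᵇ {k = suc k} Q f = Q λ a → allVecᵇ Q λ as → f (a ∷ as)

allVecᵇ-enumerates : {Q : (A → Bool) → Bool} {P : A → Set} →
                     Enumerates Q P → Enumerates (allVecᵇ {k = k} Q) (All P)
allVecᵇ-enumerates Q-enumerates f holds [] [] = holds
allVecᵇ-enumerates Q-enumerates f holds (a ∷ as) (pa ∷ pas) =
  allVecᵇ-enumerates Q-enumerates (λ as → f (a ∷ as)) (Q-enumerates _ holds a pa) as pas

-- The type checker runs the search on all 15⁴ configurations here.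
everyPairConfigurationHasC8 : (Bad : Vec (Subset 6) 4) → All (λ p → ∣ p ∣ ≡ 2) Bad →
                              ∃ (IsC8 (Compatible (lookup Bad)))
everyPairConfigurationHasC8 Bad sizes =
  to-witness-T (findC8 (lookup Bad))
    (allVecᵇ-enumerates allOfSizeᵇ-enumerates (is-just ∘ findC8 ∘ lookup) tt Bad sizes)

extendAllToSize : (bad : Fin k → Subset n) → (∀ i → ∣ bad i ∣ ≤ m) → m ≤ n →
                  Σ (Vec (Subset n) k) λ qs → All (λ q → ∣ q ∣ ≡ m) qs × (∀ i → bad i ⊆ lookup qs i)
extendAllToSize {k = k} {n = n} {m = m} bad ∣bad∣≤m m≤n =
  tabulate extension ,
  tabulate⁺ (proj₂ ∘ proj₂ ∘ extended) ,
  λ i → subst (bad i ⊆_) (sym (lookup∘tabulate extension i)) (proj₁ (proj₂ (extended i)))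
  where
  extended : ∀ i → Σ (Subset n) λ q → bad i ⊆ q × ∣ q ∣ ≡ m
  extended i = extendToSize (bad i) (∣bad∣≤m i) m≤n

  extension : Fin k → Subset n
  extension = proj₁ ∘ extended

[,]-injective : {f : A → Fin n} {g : B → Fin n} →
                Injective _≡_ _≡_ f → Injective _≡_ _≡_ g → (∀ a b → f a ≢ g b) →
                Injective _≡_ _≡_ [ f , g ]
[,]-injective f-injective g-injective f≢g {inj₁ a} {inj₁ a′} eq = cong inj₁ (f-injective eq)
[,]-injective f-injective g-injective f≢g {inj₂ b} {inj₂ b′} eq = cong inj₂ (g-injective eq)
[,]-injective f-injective g-injective f≢g {inj₁ a} {inj₂ b} eq = ⊥-elim (f≢g a b eq)
[,]-injective f-injective g-injective f≢g {inj₂ b} {inj₁ a} eq = ⊥-elim (f≢g a b (sym eq))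

module FourAgainstSix {n} (G : Graph n) {U V : Subset n} (disjoint : Disjoint U V)
         (degree : ∀ x → x ∈ U → ∣ neighboursIn G x V ∣ ≤ 2)
         {u : Fin 4 → Fin n} (u-injective : Injective _≡_ _≡_ u) (u∈U : ∀ i → u i ∈ U)
         {v : Fin 6 → Fin n} (v-injective : Injective _≡_ _≡_ v) (v∈V : ∀ j → v j ∈ V) where

  adjacent : Fin 4 → Fin 6 → Bool
  adjacent i j = adj G (u i) (v j)

  neighbourIndices : Fin 4 → Subset 6
  neighbourIndices i = tabulate (adjacent i)

  ∣neighbourIndices∣≤2 : ∀ i → ∣ neighbourIndices i ∣ ≤ 2
  ∣neighbourIndices∣≤2 i = ≤-trans (injective⇒∣p∣≤∣q∣ v v-injective v-maps) (degree (u i) (u∈U i))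
    where
    v-maps : ∀ {j} → j ∈ neighbourIndices i → v j ∈ neighboursIn G (u i) V
    v-maps {j} j∈ = ∈-tabulate⁺ _ (cong₂ _∧_ ([]=⇒lookup (v∈V j)) (∈-tabulate⁻ (adjacent i) j∈))

  compatible⇒complEdge : ∀ {x y} → Compatible neighbourIndices x y →
                         ComplEdge G ([ u , v ] x) ([ u , v ] y)
  compatible⇒complEdge {inj₁ i} {inj₂ j} j∉ = ∉-tabulate⁻ (adjacent i) j∉
  compatible⇒complEdge {inj₂ j} {inj₁ i} j∉ =
    trans (Graph.sym G (v j) (u i)) (∉-tabulate⁻ (adjacent i) j∉)

  u≢v : ∀ i j → u i ≢ v j
  u≢v i j eq = disjoint (u i , x∈p∩q⁺ (u∈U i , subst (_∈ V) (sym eq) (v∈V j)))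

  [u,v]-∈ : ∀ x → [ u , v ] x ∈ U ∪ V
  [u,v]-∈ (inj₁ i) = x∈p∪q⁺ (inj₁ (u∈U i))
  [u,v]-∈ (inj₂ j) = x∈p∪q⁺ (inj₂ (v∈V j))

  hasComplC8 : HasComplC8 G (U ∪ V)
  hasComplC8 =
    let Bad , sizes , neighbours⊆Bad =
          extendAllToSize neighbourIndices ∣neighbourIndices∣≤2 (s≤s (s≤s z≤n))
        _ , isC8 = everyPairConfigurationHasC8 Bad sizes
    in IsC8⇒HasComplC8 G (U ∪ V) [ u , v ] ([,]-injective u-injective v-injective u≢v) [u,v]-∈
         compatible⇒complEdge (IsC8-mono (Compatible-antitone neighbours⊆Bad) isC8)

corollary1 : (n : ℕ) (G : Graph n) (U V : Subset n) →
    Disjoint U V →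
    (∀ u → u ∈ U → ∣ neighboursIn G u V ∣ ≤ 2) →
    4 ≤ ∣ U ∣ →
    6 ≤ ∣ V ∣ →
    HasComplC8 G (U ∪ V)
corollary1 n G U V disjoint degree 4≤∣U∣ 6≤∣V∣ =
  let u , u-injective , u∈U = ≤∣p∣⇒injection U 4≤∣U∣
      v , v-injective , v∈V = ≤∣p∣⇒injection V 6≤∣V∣
  in FourAgainstSix.hasComplC8 G disjoint degree u-injective u∈U v-injective v∈V
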